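{- Let $F$ be a forest, let $k,s\ge 0$ be integers, and for $1\le i\le s$ let $\mathcal{F}_i$ be a set of $s!\,k$ paths of $F$ that are pairwise anticomplete. Then there exist $P^i_1,\ldots,P^i_k\in\mathcal{F}_i$ for $1\le i\le s$ such that these $sk$ paths are pairwise anticomplete.
   Context: Two subgraphs of a graph are anticomplete if their vertex sets are disjoint and no edge of the graph joins them. -}

module Defs where

open import Data.Nat using (ℕ; zero; suc; _+_; _≥_)
open import Data.Fin using (Fin; zero; suc; inject₁; fromℕ)
open import Data.Bool using (Bool; true; false)
open import Data.Product using (Σ; _×_; _,_)
open import Relation.Binary.PropositionalEquality using (_≡_; _≢_)
open import Relation.Nullary using (¬_)
open import Function.Definitions using (Injective)

record Graph : Set where
  field
    n     : ℕ
    adj   : Fin n → Fin n → Bool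
    sym   : ∀ u v → adj u v ≡ adj v u
    irrefl : ∀ v → adj v v ≡ false

open Graph public

Adj : (G : Graph) → Fin (n G) → Fin (n G) → Set
Adj G u v = adj G u v ≡ true

record Path (G : Graph) : Set where
  field
    len   : ℕ
    vert  : Fin (suc len) → Fin (n G)
    inj   : Injective _≡_ _≡_ vert
    step  : ∀ (i : Fin len) → Adj G (vert (inject₁ i)) (vert (suc i))

open Path public

record Cycle (G : Graph) : Set where
  field
    clen   : ℕ
    cvert  : Fin (suc (suc (suc clen))) → Fin (n G)
    cinj   : Injective _≡_ _≡_ cvert
    cstep  : ∀ (i : Fin (suc (suc clen))) → Adj G (cvert (inject₁ i)) (cvert (suc i))
    cclose : Adj G (cvert (fromℕ (suc (suc clen)))) (cvert zero)

Forest : Graph → Set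
Forest G = ¬ Cycle G

Anticomplete : {G : Graph} → Path G → Path G → Set
Anticomplete {G} P Q =
  ∀ (a : Fin (suc (len P))) (b : Fin (suc (len Q))) →
    (vert P a ≢ vert Q b) × (¬ Adj G (vert P a) (vert Q b))

-- Root every component of the forest, and call the vertex of a path closest to
-- the root its apex.  If Q touches P and the apex of Q is no deeper than that of
-- P, then Q contains the apex of P or its parent; so two such paths touch each
-- other, and a family of pairwise anticomplete paths contains at most one of
-- them.  Now repeatedly keep, among the remaining paths of the families that
-- still need paths, one whose apex is deepest, and discard every path touching
-- it: each family loses at most one path per step, so s·k paths per family
-- suffice, and s·k ≤ s!·k.

module Submission where

open import Defs hiding (sym)
open import Data.Nat as ℕ using (ℕ; zero; suc; pred; _+_; _*_; _∸_; _!; _≤_; _<_; z≤n; s≤s)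
import Data.Nat.Properties as ℕ
open import Data.Nat.GeneralisedArithmetic using (fold)
open import Data.Nat.Induction using (<-wellFounded)
open import Data.Fin as Fin using (Fin; zero; suc; toℕ; inject₁; fromℕ<)
import Data.Fin.Properties as Fin
open import Data.Bool using (true)
import Data.Bool as Bool
open import Data.Maybe using (Maybe; just; nothing)
open import Data.Maybe.Properties using (just-injective)
open import Data.Product using (Σ; ∃; ∃₂; _×_; _,_; proj₁; proj₂)
open import Data.Product.Properties using (,-injective; ≡-dec)
open import Data.Sum using (_⊎_; inj₁; inj₂)
open import Data.Empty using (⊥; ⊥-elim)
open import Data.List using (List; []; _∷_; length; filter; lookup; allFin; cartesianProduct)
import Data.List.Relation.Unary.All as All
open import Data.List.Membership.Propositional.Properties using (∈-allFin; ∈-lookup)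
open import Data.List.Extrema.Nat using (argmin; argmax; argmax-all; f[argmin]≤f[xs]; f[xs]≤f[argmax])
open import Data.Vec.Functional using (updateAt)
open import Data.Vec.Functional.Properties using (updateAt-updates; updateAt-minimal)
open import Algebra.Properties.Monoid.Sum ℕ.+-0-monoid using (sum)
open import Function using (_∘_; const; id)
open import Function.Definitions using (Injective)
open import Induction.WellFounded using (Acc; acc)
open import Level using (0ℓ)
open import Relation.Unary using (Pred; Decidable)
open import Relation.Nullary using (¬_; Dec; yes; no; contradiction)
open import Relation.Nullary.Decidable using (¬?; _×-dec_; _⊎-dec_; decidable-stable)
open import Relation.Binary using (tri<; tri≈; tri>)
open import Relation.Binary.PropositionalEquality
  using (_≡_; _≢_; refl; sym; trans; cong; subst; subst₂)

module _ (G : Graph) where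

  Adj-sym : ∀ {u v} → Adj G u v → Adj G v u
  Adj-sym {u} {v} uv = trans (Graph.sym G v u) uv

  Adj⇒≢ : ∀ {u v} → Adj G u v → u ≢ v
  Adj⇒≢ {u} uu refl with trans (sym uu) (irrefl G u)
  ... | ()

  Adj? : ∀ u v → Dec (Adj G u v)
  Adj? u v = adj G u v Bool.≟ true

  Meet : Path G → Path G → Set
  Meet P Q = ∃₂ λ a b → vert P a ≡ vert Q b ⊎ Adj G (vert P a) (vert Q b)

  ¬Anticomplete⇒Meet : ∀ {P Q} → ¬ Anticomplete P Q → Meet P Q
  ¬Anticomplete⇒Meet {P} {Q} ¬apart = decidable-stable
    (Fin.any? λ a → Fin.any? λ b → (vert P a Fin.≟ vert Q b) ⊎-dec Adj? (vert P a) (vert Q b))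
    λ ¬meet → ¬apart λ a b → (λ e → ¬meet (a , b , inj₁ e)) , (λ e → ¬meet (a , b , inj₂ e))

  Anticomplete? : ∀ P Q → Dec (Anticomplete {G} P Q)
  Anticomplete? P Q = Fin.all? λ a → Fin.all? λ b →
    ¬? (vert P a Fin.≟ vert Q b) ×-dec ¬? (Adj? (vert P a) (vert Q b))

  Anticomplete-sym : ∀ {P Q} → Anticomplete {G} P Q → Anticomplete Q P
  Anticomplete-sym apart a b = (proj₁ (apart b a) ∘ sym) , (proj₂ (apart b a) ∘ Adj-sym)

  ¬Anticomplete-refl : ∀ P → ¬ Anticomplete {G} P P
  ¬Anticomplete-refl P apart = proj₁ (apart zero zero) refl

module _ (G : Graph) (w : ℕ → Fin (n G))
         (w-adj : ∀ k → Adj G (w k) (w (suc k)))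
         (w-nonbacktracking : ∀ k → w (suc (suc k)) ≢ w k) where

  private
    Repeats : ℕ → Set
    Repeats j = ∃ λ (i : Fin j) → w (toℕ i) ≡ w j

    repeats? : ∀ j → Dec (Repeats j)
    repeats? j = Fin.any? λ i → w (toℕ i) Fin.≟ w j

    someRepetition : ¬ (∀ (j : Fin (suc (n G))) → ¬ Repeats (toℕ j))
    someRepetition fresh
      with i , j , i<j , wi≡wj ← Fin.pigeonhole (ℕ.n<1+n (n G)) (w ∘ toℕ)
      = fresh j (fromℕ< i<j , trans (cong w (Fin.toℕ-fromℕ< i<j)) wi≡wj)

    firstRepetition : ∃ λ j → Repeats j × (∀ j′ → j′ < j → ¬ Repeats j′)
    firstRepetition
      with j , ¬¬repeats , earlier ←
             Fin.¬∀⟶∃¬-smallest _ (¬_ ∘ Repeats ∘ toℕ) (¬? ∘ repeats? ∘ toℕ) someRepetition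
      = toℕ j , decidable-stable (repeats? _) ¬¬repeats , λ j′ j′<j →
          subst (¬_ ∘ Repeats) (trans (Fin.toℕ-inject _) (Fin.toℕ-fromℕ< j′<j)) (earlier (fromℕ< j′<j))

    closedSegment⇒Cycle : ∀ i c → w (suc (suc (suc c)) + i) ≡ w i →
      (∀ a b → a < b → b < suc (suc (suc c)) + i → w a ≢ w b) → Cycle G
    closedSegment⇒Cycle i c closes distinct = record
      { clen = c
      ; cvert = segment
      ; cinj = segment-injective
      ; cstep = λ m → subst (λ x → Adj G (w (x + i)) (w (suc (toℕ m + i))))
                            (sym (Fin.toℕ-inject₁ m)) (w-adj (toℕ m + i))
      ; cclose = subst (λ x → Adj G (w (x + i)) (w i)) (sym (Fin.toℕ-fromℕ (suc (suc c))))
                       (subst (Adj G _) closes (w-adj (suc (suc c) + i)))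
      }
      where
      segment : Fin (suc (suc (suc c))) → Fin (n G)
      segment m = w (toℕ m + i)

      in-range : ∀ m → toℕ m + i < suc (suc (suc c)) + i
      in-range m = ℕ.+-monoˡ-< i (Fin.toℕ<n m)

      segment-injective : ∀ {a b} → segment a ≡ segment b → a ≡ b
      segment-injective {a} {b} eq with ℕ.<-cmp (toℕ a) (toℕ b)
      ... | tri< a<b _ _ = contradiction eq (distinct _ _ (ℕ.+-monoˡ-< i a<b) (in-range b))
      ... | tri≈ _ a≡b _ = Fin.toℕ-injective a≡b
      ... | tri> _ _ b<a = contradiction (sym eq) (distinct _ _ (ℕ.+-monoˡ-< i b<a) (in-range a))

    noRepetitionBefore : ∀ {j} → (∀ j′ → j′ < j → ¬ Repeats j′) → ∀ a b → a < b → b < j → w a ≢ w b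
    noRepetitionBefore first a b a<b b<j wa≡wb =
      first b b<j (fromℕ< a<b , trans (cong w (Fin.toℕ-fromℕ< a<b)) wa≡wb)

    closedWalk⇒Cycle : ∀ d i → w (d + i) ≡ w i → 0 < d →
      (∀ a b → a < b → b < d + i → w a ≢ w b) → Cycle G
    closedWalk⇒Cycle (suc zero) i closes _ _ = contradiction closes (Adj⇒≢ G (Adj-sym G (w-adj i)))
    closedWalk⇒Cycle (suc (suc zero)) i closes _ _ = contradiction closes (w-nonbacktracking i)
    closedWalk⇒Cycle (suc (suc (suc c))) i closes _ distinct = closedSegment⇒Cycle i c closes distinct

  nonBacktrackingWalk⇒Cycle : Cycle G
  nonBacktrackingWalk⇒Cycle
    with j , (i , wi≡wj) , first ← firstRepetition
    = closedWalk⇒Cycle (j ∸ toℕ i) (toℕ i) closes (ℕ.m<n⇒0<n∸m (Fin.toℕ<n i))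
        λ a b a<b b<j → noRepetitionBefore first a b a<b (subst (b <_) gap b<j)
    where
    gap : (j ∸ toℕ i) + toℕ i ≡ j
    gap = ℕ.m∸n+n≡m (ℕ.<⇒≤ (Fin.toℕ<n i))
    closes : w ((j ∸ toℕ i) + toℕ i) ≡ w (toℕ i)
    closes = trans (cong w gap) (sym wi≡wj)

module _ where

  open import Data.Vec using ([]; _∷_; here; there)
  open import Data.Fin.Subset using (Subset; _∈_; _∉_; _─_; _-_; ⁅_⁆; ∣_∣; Nonempty; Empty; outside)
    renaming (⊤ to full)
  open import Data.Fin.Subset.Properties
    using (_∈?_; ∈⊤; x∈⁅x⁆; p─q⊆p; x∈p∧x≢y⇒x∈p-y; x∈p⇒∣p-x∣<∣p∣; nonempty?)

  x∈p─q⇒x∉q : ∀ {m} {x : Fin m} (p q : Subset m) → x ∈ p ─ q → x ∉ q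
  x∈p─q⇒x∉q (_ ∷ p) (outside ∷ q) here ()
  x∈p─q⇒x∉q (_ ∷ p) (_ ∷ q) (there x∈p─q) (there x∈q) = x∈p─q⇒x∉q p q x∈p─q x∈q

  x∈p-y⇒x≢y : ∀ {m} {x y : Fin m} (p : Subset m) → x ∈ p - y → x ≢ y
  x∈p-y⇒x≢y {y = y} p x∈p-y refl = x∈p─q⇒x∉q p ⁅ y ⁆ x∈p-y (x∈⁅x⁆ y)

  module _ (G : Graph) where

    private
      V = Fin (n G)

    TwoNeighboursIn : Subset (n G) → V → Set
    TwoNeighboursIn A x = ∃₂ λ u v → u ∈ A × v ∈ A × Adj G x u × Adj G x v × u ≢ v

    twoNeighboursIn? : ∀ A x → Dec (TwoNeighboursIn A x)
    twoNeighboursIn? A x = Fin.any? λ u → Fin.any? λ v →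
      (u ∈? A) ×-dec (v ∈? A) ×-dec Adj? G x u ×-dec Adj? G x v ×-dec ¬? (u Fin.≟ v)

    Leaf : Subset (n G) → V → Set
    Leaf A ℓ = ℓ ∈ A × (∀ {u v} → u ∈ A → v ∈ A → Adj G ℓ u → Adj G ℓ v → u ≡ v)

    module _ {A : Subset (n G)} (branching : ∀ {x} → x ∈ A → TwoNeighboursIn A x) where

      private
        State = V × Σ V (_∈ A)

        current : State → V
        current (_ , x , _) = x

        neighbourAvoiding : ∀ {x} → x ∈ A → (p : V) → Σ V λ y → y ∈ A × Adj G x y × y ≢ p
        neighbourAvoiding x∈A p with u , v , u∈A , v∈A , xu , xv , u≢v ← branching x∈A with u Fin.≟ p
        ... | yes refl = v , v∈A , xv , u≢v ∘ sym
        ... | no u≢p = u , u∈A , xu , u≢p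

        advance : State → State
        advance (p , x , x∈A) with y , y∈A , _ ← neighbourAvoiding x∈A p = x , y , y∈A

        advance-adj : ∀ st → Adj G (current st) (current (advance st))
        advance-adj (p , x , x∈A) = proj₁ (proj₂ (proj₂ (neighbourAvoiding x∈A p)))

        advance-avoids : ∀ st → current (advance (advance st)) ≢ current st
        advance-avoids (p , x , x∈A) = proj₂ (proj₂ (proj₂ (neighbourAvoiding _ x)))

      branching⇒Cycle : ∀ {x} → x ∈ A → Cycle G
      branching⇒Cycle {x} x∈A = nonBacktrackingWalk⇒Cycle G (current ∘ walk)
        (advance-adj ∘ walk) (advance-avoids ∘ walk)
        where
        walk : ℕ → State
        walk = fold (x , x , x∈A) advance

    leaf-exists : Forest G → ∀ {A} → Nonempty A → ∃ (Leaf A)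
    leaf-exists forest {A} (x , x∈A) with Fin.any? (λ ℓ → (ℓ ∈? A) ×-dec ¬? (twoNeighboursIn? A ℓ))
    ... | yes (ℓ , ℓ∈A , ¬two) = ℓ , ℓ∈A , λ {u} {v} u∈A v∈A ℓu ℓv →
            decidable-stable (u Fin.≟ v) (λ u≢v → ¬two (u , v , u∈A , v∈A , ℓu , ℓv , u≢v))
    ... | no noLeaf = ⊥-elim (forest (branching⇒Cycle branching x∈A))
      where
      branching : ∀ {y} → y ∈ A → TwoNeighboursIn A y
      branching {y} y∈A = decidable-stable (twoNeighboursIn? A y) λ ¬two → noLeaf (y , y∈A , ¬two)

  record Rooting (G : Graph) (A : Subset (n G)) : Set where
    field
      parent       : Fin (n G) → Maybe (Fin (n G))
      depth        : Fin (n G) → ℕ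
      parent∈      : ∀ {v u} → parent v ≡ just u → u ∈ A
      parent-adj   : ∀ {v u} → parent v ≡ just u → Adj G v u
      depth-parent : ∀ {v u} → parent v ≡ just u → depth v ≡ suc (depth u)
      edge⇒parent  : ∀ {u v} → u ∈ A → v ∈ A → Adj G u v → parent u ≡ just v ⊎ parent v ≡ just u

  module _ {G : Graph} where

    private
      V = Fin (n G)

    Rooting-empty : ∀ {A} → Empty A → Rooting G A
    Rooting-empty empty = record
      { parent = const nothing ; depth = const 0
      ; parent∈ = λ () ; parent-adj = λ () ; depth-parent = λ ()
      ; edge⇒parent = λ u∈A _ _ → ⊥-elim (empty (_ , u∈A)) }

    module _ {A : Subset (n G)} {ℓ : V} (R : Rooting G (A - ℓ)) (anchor : Maybe V)
             (anchor-adj : ∀ {u} → anchor ≡ just u → u ∈ A × Adj G ℓ u)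
             (anchor-unique : ∀ {u} → u ∈ A → Adj G ℓ u → anchor ≡ just u) where

      open Rooting R

      private
        depthBelow : Maybe V → ℕ
        depthBelow (just u) = suc (depth u)
        depthBelow nothing  = 0

        parent′ : V → Maybe V
        parent′ = updateAt parent ℓ (const anchor)

        depth′ : V → ℕ
        depth′ = updateAt depth ℓ (const (depthBelow anchor))

        parent′-ℓ : parent′ ℓ ≡ anchor
        parent′-ℓ = updateAt-updates ℓ parent

        parent′-other : ∀ {v} → v ≢ ℓ → parent′ v ≡ parent v
        parent′-other v≢ℓ = updateAt-minimal _ ℓ parent v≢ℓ

        depth′-other : ∀ {v} → v ≢ ℓ → depth′ v ≡ depth v
        depth′-other v≢ℓ = updateAt-minimal _ ℓ depth v≢ℓ

        parent∈′ : ∀ {v u} → parent′ v ≡ just u → u ∈ A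
        parent∈′ {v} e with v Fin.≟ ℓ
        ... | yes refl = proj₁ (anchor-adj (trans (sym parent′-ℓ) e))
        ... | no v≢ℓ = p─q⊆p A ⁅ ℓ ⁆ (parent∈ (trans (sym (parent′-other v≢ℓ)) e))

        parent-adj′ : ∀ {v u} → parent′ v ≡ just u → Adj G v u
        parent-adj′ {v} e with v Fin.≟ ℓ
        ... | yes refl = proj₂ (anchor-adj (trans (sym parent′-ℓ) e))
        ... | no v≢ℓ = parent-adj (trans (sym (parent′-other v≢ℓ)) e)

        depth-parent′ : ∀ {v u} → parent′ v ≡ just u → depth′ v ≡ suc (depth′ u)
        depth-parent′ {v} {u} e with v Fin.≟ ℓ
        ... | yes refl = trans (updateAt-updates ℓ depth)
                           (trans (cong depthBelow anchor≡u) (cong suc (sym (depth′-other u≢ℓ))))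
          where
          anchor≡u : anchor ≡ just u
          anchor≡u = trans (sym parent′-ℓ) e
          u≢ℓ : u ≢ ℓ
          u≢ℓ = Adj⇒≢ G (proj₂ (anchor-adj anchor≡u)) ∘ sym
        ... | no v≢ℓ = trans (depth′-other v≢ℓ) (trans (depth-parent e′)
                         (cong suc (sym (depth′-other (x∈p-y⇒x≢y A (parent∈ e′))))))
          where
          e′ : parent v ≡ just u
          e′ = trans (sym (parent′-other v≢ℓ)) e

        edge⇒parent′ : ∀ {u v} → u ∈ A → v ∈ A → Adj G u v → parent′ u ≡ just v ⊎ parent′ v ≡ just u
        edge⇒parent′ {u} {v} u∈A v∈A uv with u Fin.≟ ℓ | v Fin.≟ ℓ
        ... | yes refl | _ = inj₁ (trans parent′-ℓ (anchor-unique v∈A uv))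
        ... | no _ | yes refl = inj₂ (trans parent′-ℓ (anchor-unique u∈A (Adj-sym G uv)))
        ... | no u≢ℓ | no v≢ℓ
          with edge⇒parent (x∈p∧x≢y⇒x∈p-y u∈A u≢ℓ) (x∈p∧x≢y⇒x∈p-y v∈A v≢ℓ) uv
        ... | inj₁ e = inj₁ (trans (parent′-other u≢ℓ) e)
        ... | inj₂ e = inj₂ (trans (parent′-other v≢ℓ) e)

      Rooting-attach : Rooting G A
      Rooting-attach = record
        { parent = parent′ ; depth = depth′ ; parent∈ = parent∈′ ; parent-adj = parent-adj′
        ; depth-parent = depth-parent′ ; edge⇒parent = edge⇒parent′ }

    Rooting-attachLeaf : ∀ {A ℓ} → Leaf G A ℓ → Rooting G (A - ℓ) → Rooting G A
    Rooting-attachLeaf {A} {ℓ} (_ , unique) R with Fin.any? (λ u → (u ∈? A) ×-dec Adj? G ℓ u)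
    ... | yes (u , u∈A , ℓu) = Rooting-attach R (just u) (λ { refl → u∈A , ℓu })
                                 λ v∈A ℓv → cong just (unique u∈A v∈A ℓu ℓv)
    ... | no isolated = Rooting-attach R nothing (λ ())
                          λ v∈A ℓv → ⊥-elim (isolated (_ , v∈A , ℓv))

    forest⇒Rooting : Forest G → ∀ A → Rooting G A
    forest⇒Rooting forest A = go A (<-wellFounded ∣ A ∣)
      where
      go : ∀ A → Acc _<_ ∣ A ∣ → Rooting G A
      go A (acc smaller) with nonempty? A
      ... | no empty = Rooting-empty empty
      ... | yes nonempty with ℓ , leaf ← leaf-exists G forest nonempty =
        Rooting-attachLeaf leaf (go (A - ℓ) (smaller (x∈p⇒∣p-x∣<∣p∣ (proj₁ leaf))))

  module RootedPaths {G : Graph} (R : Rooting G full) where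

    open Rooting R

    private
      V = Fin (n G)

    edge⇒link : ∀ {u v} → Adj G u v → parent u ≡ just v ⊎ parent v ≡ just u
    edge⇒link = edge⇒parent ∈⊤ ∈⊤

    parent-deeper : ∀ {v u} → parent v ≡ just u → depth u < depth v
    parent-deeper e = ℕ.≤-reflexive (sym (depth-parent e))

    Linked : ∀ {k} → (Fin (suc k) → V) → Set
    Linked {k} f = ∀ (i : Fin k) →
      parent (f (inject₁ i)) ≡ just (f (suc i)) ⊎ parent (f (suc i)) ≡ just (f (inject₁ i))

    Shallowest : ∀ {k} → (Fin (suc k) → V) → Fin (suc k) → Set
    Shallowest f a = ∀ b → b ≢ a → depth (f a) < depth (f b)

    Shallowest⇒≤ : ∀ {k} {f : Fin (suc k) → V} {a} → Shallowest f a → ∀ b → depth (f a) ≤ depth (f b)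
    Shallowest⇒≤ {a = a} shallowest b with b Fin.≟ a
    ... | yes refl = ℕ.≤-refl
    ... | no b≢a = ℕ.<⇒≤ (shallowest b b≢a)

    descending⇒Shallowest : ∀ {k} {f : Fin (suc k) → V} →
      (∀ i → parent (f (suc i)) ≡ just (f (inject₁ i))) → Shallowest f zero
    descending⇒Shallowest chain zero 0≢0 = contradiction refl 0≢0
    descending⇒Shallowest {suc k} chain (suc zero) _ = parent-deeper (chain zero)
    descending⇒Shallowest {suc k} {f} chain (suc (suc b)) _ =
      ℕ.<-trans (parent-deeper (chain zero)) (descending⇒Shallowest {f = f ∘ suc} (chain ∘ suc) (suc b) λ ())

    Injective-tail : ∀ {k} {f : Fin (suc k) → V} → Injective _≡_ _≡_ f → Injective _≡_ _≡_ (f ∘ suc)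
    Injective-tail f-injective = Fin.suc-injective ∘ f-injective

    -- In a tree, a path that steps down once keeps stepping down: climbing back
    -- would revisit the vertex it came from.
    descending : ∀ {k} {f : Fin (suc (suc k)) → V} → Injective _≡_ _≡_ f → Linked f →
      parent (f (suc zero)) ≡ just (f zero) → ∀ i → parent (f (suc i)) ≡ just (f (inject₁ i))
    descending _ _ down zero = down
    descending {suc k} f-injective f-linked down (suc i) with f-linked (suc zero)
    ... | inj₂ down′ = descending (Injective-tail f-injective) (f-linked ∘ suc) down′ i
    ... | inj₁ up = contradiction (f-injective (just-injective (trans (sym down) up))) λ ()

    Shallowest-or-parent∈ : ∀ {k} {f : Fin (suc k) → V} → Injective _≡_ _≡_ f → Linked f →
      ∀ a → Shallowest f a ⊎ ∃ λ c → parent (f a) ≡ just (f c)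
    Shallowest-or-parent∈ {zero} _ _ zero = inj₁ λ { zero 0≢0 → contradiction refl 0≢0 }
    Shallowest-or-parent∈ {suc k} f-injective f-linked a with f-linked zero | a
    ... | inj₂ down | zero = inj₁ (descending⇒Shallowest (descending f-injective f-linked down))
    ... | inj₂ down | suc i = inj₂ (inject₁ i , descending f-injective f-linked down i)
    ... | inj₁ up | zero = inj₂ (suc zero , up)
    ... | inj₁ up | suc i with Shallowest-or-parent∈ (Injective-tail f-injective) (f-linked ∘ suc) i
    ...   | inj₂ (c , e) = inj₂ (suc c , e)
    ...   | inj₁ shallowest = inj₁ λ
            { zero _ → ℕ.≤-<-trans (Shallowest⇒≤ shallowest zero) (parent-deeper up)
            ; (suc b) b≢a → shallowest b (b≢a ∘ cong suc) }

    module _ {k} {f : Fin (suc k) → V} (f-injective : Injective _≡_ _≡_ f) (f-linked : Linked f) where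

      parent∈-of-nonminimal : ∀ {a b} → depth (f b) < depth (f a) → ∃ λ c → parent (f a) ≡ just (f c)
      parent∈-of-nonminimal {a} {b} b<a with Shallowest-or-parent∈ f-injective f-linked a
      ... | inj₂ found = found
      ... | inj₁ shallowest = contradiction (Shallowest⇒≤ shallowest b) (ℕ.<⇒≱ b<a)

      minimum-unique : ∀ {a t} → (∀ b → depth (f t) ≤ depth (f b)) → depth (f a) ≡ depth (f t) → a ≡ t
      minimum-unique {a} {t} minimal a≈t with Shallowest-or-parent∈ f-injective f-linked a
      ... | inj₂ (c , e) = contradiction (minimal c) (ℕ.<⇒≱ (subst (depth (f c) <_) a≈t (parent-deeper e)))
      ... | inj₁ shallowest with a Fin.≟ t
      ...   | yes a≡t = a≡t
      ...   | no a≢t = contradiction a≈t (ℕ.<⇒≢ (shallowest t (a≢t ∘ sym)))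

    vert-linked : (P : Path G) → Linked (vert P)
    vert-linked P i = edge⇒link (step P i)

    top : (P : Path G) → Fin (suc (len P))
    top P = argmin (depth ∘ vert P) zero (allFin _)

    apex : Path G → V
    apex P = vert P (top P)

    apexDepth : Path G → ℕ
    apexDepth P = depth (apex P)

    apexDepth≤depth : ∀ P a → apexDepth P ≤ depth (vert P a)
    apexDepth≤depth P a = All.lookup (f[argmin]≤f[xs] {f = depth ∘ vert P} zero (allFin _)) (∈-allFin a)

    apex-unique : ∀ {P a} → depth (vert P a) ≡ apexDepth P → vert P a ≡ apex P
    apex-unique {P} = cong (vert P) ∘ minimum-unique (inj P) (vert-linked P) (apexDepth≤depth P)

    _∈ᵥ_ : V → Path G → Set
    v ∈ᵥ P = ∃ λ a → vert P a ≡ v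

    Covers : Path G → V → Set
    Covers Q t = t ∈ᵥ Q ⊎ ∃ λ u → parent t ≡ just u × u ∈ᵥ Q

    module _ (P Q : Path G) (Q-higher : apexDepth Q ≤ apexDepth P) where

      private
        parent∈P : ∀ {a} → apexDepth P < depth (vert P a) → ∃ λ c → parent (vert P a) ≡ just (vert P c)
        parent∈P = parent∈-of-nonminimal (inj P) (vert-linked P) {b = top P}

        parent∈Q : ∀ {b} → apexDepth P < depth (vert Q b) → ∃ λ c → parent (vert Q b) ≡ just (vert Q c)
        parent∈Q lt = parent∈-of-nonminimal (inj Q) (vert-linked Q) {b = top Q} (ℕ.≤-<-trans Q-higher lt)

        below : ∀ {h d} → d ≡ suc h + apexDepth P → apexDepth P < d
        below {h} eq = subst (apexDepth P <_) (sym eq) (ℕ.s≤s (ℕ.m≤n+m _ h))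

        -- Climb from a common vertex of P and Q to the apex of P: above the apex,
        -- parents of vertices of P stay in P and, as Q reaches at least as high, in Q.
        common⇒apex∈Q′ : ∀ h a → depth (vert P a) ≡ h + apexDepth P → vert P a ∈ᵥ Q → apex P ∈ᵥ Q
        common⇒apex∈Q′ zero a a-at-top (b , Pa≡Qb) =
          b , trans Pa≡Qb (apex-unique {P} a-at-top)
        common⇒apex∈Q′ (suc h) a a-below (b , Qb≡Pa)
          with c , Pa↑Pc ← parent∈P (below a-below)
          with c′ , Qb↑Qc′ ← parent∈Q (subst (λ v → apexDepth P < depth v) (sym Qb≡Pa) (below a-below))
          = common⇒apex∈Q′ h c (ℕ.suc-injective (trans (sym (depth-parent Pa↑Pc)) a-below))
              (c′ , just-injective (trans (sym Qb↑Qc′) (trans (cong parent Qb≡Pa) Pa↑Pc)))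

      common⇒apex∈Q : ∀ {a} → vert P a ∈ᵥ Q → apex P ∈ᵥ Q
      common⇒apex∈Q {a} =
        common⇒apex∈Q′ (depth (vert P a) ∸ apexDepth P) a (sym (ℕ.m∸n+n≡m (apexDepth≤depth P a)))

      Meet⇒Covers : Meet G P Q → Covers Q (apex P)
      Meet⇒Covers (a , b , inj₁ Pa≡Qb) = inj₁ (common⇒apex∈Q (b , sym Pa≡Qb))
      Meet⇒Covers (a , b , inj₂ edge) with edge⇒link edge
      ... | inj₂ Qb↑Pa with c , Qb↑Qc ← parent∈Q (ℕ.≤-<-trans (apexDepth≤depth P a) (parent-deeper Qb↑Pa))
        = inj₁ (common⇒apex∈Q (c , just-injective (trans (sym Qb↑Qc) Qb↑Pa)))
      ... | inj₁ Pa↑Qb with ℕ.m≤n⇒m<n∨m≡n (apexDepth≤depth P a)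
      ...   | inj₁ a-below with c , Pa↑Pc ← parent∈P a-below
        = inj₁ (common⇒apex∈Q (b , just-injective (trans (sym Pa↑Qb) Pa↑Pc)))
      ...   | inj₂ a-at-top =
        inj₂ (vert Q b , subst (λ v → parent v ≡ just (vert Q b)) (apex-unique {P} (sym a-at-top)) Pa↑Qb , b , refl)

    Covers-apart : ∀ {Q Q′ t} → Anticomplete Q Q′ → Covers Q t → Covers Q′ t → ⊥
    Covers-apart apart (inj₁ (a , Qa≡t)) (inj₁ (b , Q′b≡t)) = proj₁ (apart a b) (trans Qa≡t (sym Q′b≡t))
    Covers-apart apart (inj₁ (a , refl)) (inj₂ (u , t↑u , b , refl)) = proj₂ (apart a b) (parent-adj t↑u)
    Covers-apart apart (inj₂ (u , t↑u , a , refl)) (inj₁ (b , refl)) =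
      proj₂ (apart a b) (Adj-sym G (parent-adj t↑u))
    Covers-apart apart (inj₂ (u , t↑u , a , Qa≡u)) (inj₂ (u′ , t↑u′ , b , Q′b≡u′)) =
      proj₁ (apart a b) (trans Qa≡u (trans (just-injective (trans (sym t↑u) t↑u′)) (sym Q′b≡u′)))

    contacts-touch : ∀ {P Q Q′} → apexDepth Q ≤ apexDepth P → apexDepth Q′ ≤ apexDepth P →
      ¬ Anticomplete P Q → ¬ Anticomplete P Q′ → ¬ Anticomplete Q Q′
    contacts-touch {P} {Q} {Q′} Q-higher Q′-higher PQ PQ′ apart =
      Covers-apart {Q} {Q′} apart (Meet⇒Covers P Q Q-higher (¬Anticomplete⇒Meet G {P} {Q} PQ))
                         (Meet⇒Covers P Q′ Q′-higher (¬Anticomplete⇒Meet G {P} {Q′} PQ′))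

module _ where

  open import Data.List.Properties using (filter-all; length-tabulate)
  open import Data.List.Relation.Unary.Any using (here; there)
  open import Data.List.Relation.Unary.All.Properties using (all-filter)
  open import Data.List.Relation.Unary.AllPairs using ([]; _∷_)
  open import Data.List.Relation.Unary.Unique.Propositional using (Unique)
  import Data.List.Relation.Unary.Unique.Propositional.Properties as Unique
  open import Data.List.Membership.Propositional using (_∈_)
  open import Data.List.Membership.Propositional.Properties
    using (∈-filter⁺; ∈-filter⁻; ∈-cartesianProduct⁺)
  open import Data.List.Relation.Binary.Subset.Propositional using (_⊆_)

  length-filter-atMostOne : ∀ {A : Set} {P : Pred A 0ℓ} (P? : Decidable P) {xs : List A} → Unique xs →
    (∀ {x y} → x ∈ xs → y ∈ xs → ¬ P x → ¬ P y → x ≡ y) → length xs ≤ suc (length (filter P? xs))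
  length-filter-atMostOne P? {[]} _ _ = z≤n
  length-filter-atMostOne {P = P} P? {x ∷ xs} (x∉xs ∷ unique) atMostOne with P? x
  ... | yes _ = s≤s (length-filter-atMostOne P? unique λ x∈ y∈ → atMostOne (there x∈) (there y∈))
  ... | no ¬Px = s≤s (ℕ.≤-reflexive (sym (cong length (filter-all P? (All.tabulate others-pass)))))
    where
    others-pass : ∀ {y} → y ∈ xs → P y
    others-pass {y} y∈xs = decidable-stable (P? y) λ ¬Py →
      All.lookup x∉xs y∈xs (atMostOne (here refl) (there y∈xs) ¬Px ¬Py)

  Unique-lookup-injective : ∀ {A : Set} {xs : List A} → Unique xs → ∀ i j → lookup xs i ≡ lookup xs j → i ≡ j
  Unique-lookup-injective {xs = _ ∷ _} _ zero zero _ = refl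
  Unique-lookup-injective {xs = _ ∷ _} (x∉xs ∷ _) zero (suc j) x≡ =
    contradiction x≡ (All.lookup x∉xs (∈-lookup j))
  Unique-lookup-injective {xs = _ ∷ _} (x∉xs ∷ _) (suc i) zero ≡x =
    contradiction (sym ≡x) (All.lookup x∉xs (∈-lookup i))
  Unique-lookup-injective {xs = _ ∷ _} (_ ∷ unique) (suc i) (suc j) eq =
    cong suc (Unique-lookup-injective unique i j eq)

  ≤-sum : ∀ {m} (f : Fin m → ℕ) i → f i ≤ sum f
  ≤-sum f zero = ℕ.m≤m+n (f zero) _
  ≤-sum f (suc i) = ℕ.≤-trans (≤-sum (f ∘ suc) i) (ℕ.m≤n+m _ (f zero))

  sum-positive : ∀ {m} (f : Fin m → ℕ) → 0 < sum f → ∃ λ i → 0 < f i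
  sum-positive {suc m} f pos with f zero in eq
  ... | suc _ = zero , subst (0 <_) (sym eq) (s≤s z≤n)
  ... | zero with i , fi>0 ← sum-positive (f ∘ suc) pos = suc i , fi>0

  sum-updateAt-pred : ∀ {m} (f : Fin m → ℕ) i → 0 < f i → suc (sum (updateAt f i pred)) ≡ sum f
  sum-updateAt-pred f zero fi>0 with f zero
  ... | suc _ = refl
  sum-updateAt-pred f (suc i) fi>0 =
    trans (sym (ℕ.+-suc (f zero) _)) (cong (f zero +_) (sum-updateAt-pred (f ∘ suc) i fi>0))

  sum-const : ∀ m k → sum {m} (const k) ≡ m * k
  sum-const zero k = refl
  sum-const (suc m) k = cong (k +_) (sum-const m k)

  module Selection {s N : ℕ}
    (Apart : Fin s × Fin N → Fin s × Fin N → Set)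
    (Apart? : ∀ x y → Dec (Apart x y))
    (Apart-sym : ∀ {x y} → Apart x y → Apart y x)
    (¬Apart-refl : ∀ x → ¬ Apart x x)
    (rank : Fin s × Fin N → ℕ)
    (contact-unique : ∀ {p x y} → rank x ≤ rank p → rank y ≤ rank p → proj₁ x ≡ proj₁ y →
                      ¬ Apart p x → ¬ Apart p y → x ≡ y)
    where

    open import Data.List.Membership.DecPropositional (Fin._≟_ {N}) using (_∈?_)

    Item : Set
    Item = Fin s × Fin N

    record Choice (need : Fin s → ℕ) (pool : Fin s → List (Fin N)) : Set where
      field
        chosen        : Fin s → List (Fin N)
        chosen-unique : ∀ i → Unique (chosen i)
        chosen-enough : ∀ i → need i ≤ length (chosen i)
        chosen⊆pool   : ∀ i → chosen i ⊆ pool i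
        chosen-apart  : ∀ {i j a b} → a ∈ chosen i → b ∈ chosen j → (i , a) ≢ (j , b) → Apart (i , a) (j , b)

    module _ (need : Fin s → ℕ) (pool : Fin s → List (Fin N)) (p : Item) where

      private
        i₀ = proj₁ p
        a₀ = proj₂ p

      need-after : Fin s → ℕ
      need-after = updateAt need i₀ pred

      pool-after : Fin s → List (Fin N)
      pool-after j = filter (Apart? p ∘ (j ,_)) (pool j)

      private
        chosen′ : (Fin s → List (Fin N)) → Fin s → List (Fin N)
        chosen′ chosen = updateAt chosen i₀ (a₀ ∷_)

        ∈-chosen′⁻ : ∀ {chosen j a} → a ∈ chosen′ chosen j → (j , a) ≡ p ⊎ a ∈ chosen j
        ∈-chosen′⁻ {chosen} {j} a∈ with j Fin.≟ i₀
        ... | no j≢i₀ = inj₂ (subst (_ ∈_) (updateAt-minimal j i₀ chosen j≢i₀) a∈)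
        ... | yes refl with subst (_ ∈_) (updateAt-updates i₀ chosen) a∈
        ...   | here refl = inj₁ refl
        ...   | there a∈chosen = inj₂ a∈chosen

      extend : 0 < need i₀ → a₀ ∈ pool i₀ → Choice need-after pool-after → Choice need pool
      extend need>0 a₀∈pool C = record
        { chosen = chosen′ chosen
        ; chosen-unique = unique′
        ; chosen-enough = enough′
        ; chosen⊆pool = ⊆pool′
        ; chosen-apart = apart′
        }
        where
        open Choice C

        apart-p : ∀ {j b} → b ∈ chosen j → Apart p (j , b)
        apart-p {j} b∈ = proj₂ (∈-filter⁻ (Apart? p ∘ (j ,_)) {xs = pool j} (chosen⊆pool j b∈))

        unique′ : ∀ j → Unique (chosen′ chosen j)
        unique′ j with j Fin.≟ i₀
        ... | no j≢i₀ = subst Unique (sym (updateAt-minimal j i₀ chosen j≢i₀)) (chosen-unique j)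
        ... | yes refl = subst Unique (sym (updateAt-updates i₀ chosen)) (a₀∉chosen ∷ chosen-unique i₀)
          where
          a₀∉chosen : All.All (a₀ ≢_) (chosen i₀)
          a₀∉chosen = All.tabulate λ a∈ a₀≡a →
            ¬Apart-refl p (subst (Apart p ∘ (i₀ ,_)) (sym a₀≡a) (apart-p a∈))

        enough′ : ∀ j → need j ≤ length (chosen′ chosen j)
        enough′ j with j Fin.≟ i₀
        ... | no j≢i₀ = subst₂ _≤_ (updateAt-minimal j i₀ need j≢i₀)
                          (cong length (sym (updateAt-minimal j i₀ chosen j≢i₀))) (chosen-enough j)
        ... | yes refl = subst₂ _≤_
                           (trans (cong suc (updateAt-updates i₀ need)) (ℕ.suc-pred _ {{ℕ.>-nonZero need>0}}))
                           (cong length (sym (updateAt-updates i₀ chosen))) (s≤s (chosen-enough i₀))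

        ⊆pool′ : ∀ j → chosen′ chosen j ⊆ pool j
        ⊆pool′ j a∈ with ∈-chosen′⁻ a∈
        ... | inj₁ refl = a₀∈pool
        ... | inj₂ a∈chosen = proj₁ (∈-filter⁻ (Apart? p ∘ (j ,_)) {xs = pool j} (chosen⊆pool j a∈chosen))

        apart′ : ∀ {i j a b} → a ∈ chosen′ chosen i → b ∈ chosen′ chosen j →
          (i , a) ≢ (j , b) → Apart (i , a) (j , b)
        apart′ a∈ b∈ ne with ∈-chosen′⁻ a∈ | ∈-chosen′⁻ b∈
        ... | inj₁ refl | inj₁ refl = contradiction refl ne
        ... | inj₁ refl | inj₂ b∈chosen = apart-p b∈chosen
        ... | inj₂ a∈chosen | inj₁ refl = Apart-sym (apart-p a∈chosen)
        ... | inj₂ a∈chosen | inj₂ b∈chosen = chosen-apart a∈chosen b∈chosen ne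

    Candidate : (Fin s → ℕ) → (Fin s → List (Fin N)) → Item → Set
    Candidate need pool (i , a) = 0 < need i × a ∈ pool i

    highestCandidate : ∀ need pool {x₀} → Candidate need pool x₀ →
      Σ Item λ p → Candidate need pool p × (∀ {x} → Candidate need pool x → rank x ≤ rank p)
    highestCandidate need pool {x₀} x₀-candidate =
      highest , argmax-all rank x₀-candidate (all-filter candidate? items) , below-highest
      where
      candidate? : Decidable (Candidate need pool)
      candidate? (i , a) = (0 ℕ.<? need i) ×-dec (a ∈? pool i)

      items : List Item
      items = cartesianProduct (allFin s) (allFin N)

      highest : Item
      highest = argmax rank x₀ (filter candidate? items)

      below-highest : ∀ {x} → Candidate need pool x → rank x ≤ rank highest
      below-highest {i , a} candidate = All.lookup (f[xs]≤f[argmax] x₀ (filter candidate? items))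
        (∈-filter⁺ candidate? (∈-cartesianProduct⁺ (∈-allFin i) (∈-allFin a)) candidate)

    module _ {need pool p} (highest : ∀ {x} → Candidate need pool x → rank x ≤ rank p) where

      need-after≤need : ∀ j → need-after need pool p j ≤ need j
      need-after≤need j with j Fin.≟ proj₁ p
      ... | yes refl = subst (_≤ need j) (sym (updateAt-updates j need)) ℕ.pred[n]≤n
      ... | no j≢i₀ = ℕ.≤-reflexive (updateAt-minimal j (proj₁ p) need j≢i₀)

      pool-after-shrinks : ∀ {j} → Unique (pool j) → 0 < need j →
        length (pool j) ≤ suc (length (pool-after need pool p j))
      pool-after-shrinks {j} unique need>0 = length-filter-atMostOne (Apart? p ∘ (j ,_)) unique
        λ a∈ b∈ ¬pa ¬pb → proj₂ (,-injective
          (contact-unique (highest (need>0 , a∈)) (highest (need>0 , b∈)) refl ¬pa ¬pb))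

    greedy : ∀ T need pool → sum need ≡ T → (∀ i → Unique (pool i)) →
      (∀ i → 0 < need i → T ≤ length (pool i)) → Choice need pool
    greedy zero need pool total _ _ = record
      { chosen = const []
      ; chosen-unique = const []
      ; chosen-enough = λ i → subst (need i ≤_) total (≤-sum need i)
      ; chosen⊆pool = λ _ ()
      ; chosen-apart = λ ()
      }
    greedy (suc T) need pool total unique large
      with i , need>0 ← sum-positive need (subst (0 <_) (sym total) (s≤s z≤n))
      with p , (p-need>0 , p∈pool) , highest ←
             highestCandidate need pool {i , lookup (pool i) (fromℕ< (ℕ.<-≤-trans ℕ.z<s (large i need>0)))}
               (need>0 , ∈-lookup _)
      = extend need pool p p-need>0 p∈pool
          (greedy T (need-after need pool p) (pool-after need pool p) total′ unique′ large′)
      where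
      total′ : sum (need-after need pool p) ≡ T
      total′ = ℕ.suc-injective (trans (sum-updateAt-pred need (proj₁ p) p-need>0) total)

      unique′ : ∀ j → Unique (pool-after need pool p j)
      unique′ j = Unique.filter⁺ _ (unique j)

      large′ : ∀ j → 0 < need-after need pool p j → T ≤ length (pool-after need pool p j)
      large′ j after>0 = ℕ.s≤s⁻¹ (ℕ.≤-trans (large j need>0′) (pool-after-shrinks highest (unique j) need>0′))
        where
        need>0′ : 0 < need j
        need>0′ = ℕ.<-≤-trans after>0 (need-after≤need highest j)

    selectApart : ∀ k → s * k ≤ N → Σ (Fin s → Fin k → Fin N) λ σ →
      ∀ i i′ j j′ → ¬ (i ≡ i′ × j ≡ j′) → Apart (i , σ i j) (i′ , σ i′ j′)
    selectApart k s*k≤N = σ , λ i i′ j j′ ne → chosen-apart (∈-lookup _) (∈-lookup _) (distinct ne)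
      where
      open Choice (greedy (s * k) (const k) (const (allFin N)) (sum-const s k) (λ _ → Unique.allFin⁺ N)
                          λ _ _ → subst (s * k ≤_) (sym (length-tabulate id)) s*k≤N)

      index : ∀ i → Fin k → Fin (length (chosen i))
      index i j = fromℕ< (ℕ.<-≤-trans (Fin.toℕ<n j) (chosen-enough i))

      σ : Fin s → Fin k → Fin N
      σ i j = lookup (chosen i) (index i j)

      index-injective : ∀ {i j j′} → index i j ≡ index i j′ → j ≡ j′
      index-injective e = Fin.toℕ-injective (Fin.fromℕ<-injective _ _ _ _ e)

      distinct : ∀ {i i′ j j′} → ¬ (i ≡ i′ × j ≡ j′) → (i , σ i j) ≢ (i′ , σ i′ j′)
      distinct ne eq with ,-injective eq
      ... | refl , σ≡ = ne (refl , index-injective (Unique-lookup-injective (chosen-unique _) _ _ σ≡))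

n≤n! : ∀ n → n ≤ n !
n≤n! zero = z≤n
n≤n! (suc n) = subst (_≤ suc n * n !) (ℕ.*-identityʳ (suc n)) (ℕ.*-monoʳ-≤ (suc n) (ℕ.1≤n! n))

mainTheorem7 : (G : Graph) → Forest G → (k s : ℕ) →
    (𝓕 : Fin s → Fin ((s !) * k) → Path G) →
    (∀ i (a b : Fin ((s !) * k)) → a ≢ b → Anticomplete (𝓕 i a) (𝓕 i b)) →
    Σ (Fin s → Fin k → Fin ((s !) * k)) λ σ →
    ∀ (i i′ : Fin s) (j j′ : Fin k) → ¬ ((i ≡ i′) × (j ≡ j′)) →
    Anticomplete (𝓕 i (σ i j)) (𝓕 i′ (σ i′ j′))
mainTheorem7 G forest k s 𝓕 𝓕-apart = selectApart k (ℕ.*-monoˡ-≤ k (n≤n! s))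
  where
  open RootedPaths (forest⇒Rooting forest _)

  path : Fin s × Fin ((s !) * k) → Path G
  path (i , a) = 𝓕 i a

  contact-unique : ∀ {p x y} →
    apexDepth (path x) ≤ apexDepth (path p) → apexDepth (path y) ≤ apexDepth (path p) → proj₁ x ≡ proj₁ y →
    ¬ Anticomplete (path p) (path x) → ¬ Anticomplete (path p) (path y) → x ≡ y
  contact-unique {p} {i , a} {.i , b} x-higher y-higher refl px py =
    decidable-stable (≡-dec Fin._≟_ Fin._≟_ (i , a) (i , b)) λ x≢y →
      contacts-touch {path p} {𝓕 i a} {𝓕 i b} x-higher y-higher px py (𝓕-apart i a b (x≢y ∘ cong (i ,_)))

  open Selection (λ x y → Anticomplete (path x) (path y)) (λ x y → Anticomplete? G (path x) (path y))
    (λ {x} {y} → Anticomplete-sym G {path x} {path y}) (¬Anticomplete-refl G ∘ path)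
    (apexDepth ∘ path) contact-unique
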